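{- Let $\omega\in S_n^m$. For any $i\in\{1,\dots,n\}$, $\omega(i)$ is the minimal integer $\alpha\in\{1,\dots,n\}$ such that $\alpha\ne\omega(j)$ for all $j<i$ and $\mathrm{PS}_\omega(\alpha)=\sharp\{j\in(i-m,i)\cap\{1,\dots,n\}:\ \omega(j)>\alpha\}$.
   Context: Let $m,n$ be positive integers. A permutation $\omega\in S_n$ of $\{1,\dots,n\}$ is finite $m$-stable if $\omega(x+m)>\omega(x)$ for all $1\le x\le n-m$; $S_n^m$ is the set of these. For $\omega\in S_n^m$ and $\alpha\in\{1,\dots,n\}$, $\mathrm{PS}_\omega(\alpha)$ is the number of pairs $(x,y)$ with $1\le x<y<x+m$, $y\le n$, and $\omega(x)>\omega(y)=\alpha$. -}

module Defs where

open import Data.Nat using (ℕ; _+_; _<_; _<ᵇ_; _≡ᵇ_)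
open import Data.Bool using (Bool; _∧_)
open import Data.Fin using (Fin; toℕ)
open import Data.Fin.Permutation using (Permutation′; _⟨$⟩ʳ_)
open import Data.List using (List; length; filterᵇ; allFin; cartesianProduct)
open import Data.Product using (_×_; _,_)

-- Convention: {1,…,n} is represented by Fin n = {0,…,n-1} via x ↦ toℕ x + 1
-- (both positions and values shifted by one; all conditions are
-- invariant under this uniform shift).

app : {n : ℕ} → Permutation′ n → Fin n → ℕ
app ω x = toℕ (ω ⟨$⟩ʳ x)

IsStable : (m : ℕ) {n : ℕ} → Permutation′ n → Set
IsStable m ω = ∀ x y → toℕ y ≡ toℕ x + m → app ω x < app ω y
  where open import Relation.Binary.PropositionalEquality using (_≡_)

PS : (m : ℕ) {n : ℕ} → Permutation′ n → ℕ → ℕ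
PS m {n} ω α = length (filterᵇ ok (cartesianProduct (allFin n) (allFin n)))
  where
  ok : Fin n × Fin n → Bool
  ok (x , y) = (toℕ x <ᵇ toℕ y) ∧ (toℕ y <ᵇ toℕ x + m)
             ∧ (app ω y <ᵇ app ω x) ∧ (app ω y ≡ᵇ α)

Window : (m : ℕ) {n : ℕ} → Permutation′ n → Fin n → ℕ → ℕ
Window m {n} ω i α = length (filterᵇ ok (allFin n))
  where
  ok : Fin n → Bool
  ok j = (toℕ i <ᵇ toℕ j + m) ∧ (toℕ j <ᵇ toℕ i) ∧ (α <ᵇ app ω j)

-- Fix a threshold α and count, for each position p, the entries exceeding α in
-- the window (p-m, p] ending at p.  Moving the window one step to the right
-- adds position p+1 and drops position p+1-m; by m-stability, if the entry that
-- drops out exceeds α then so does the one that comes in, so this count is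
-- nondecreasing in p.  At a position k with ω(k) = α it equals Window(k, α),
-- which is PS_ω(α); at a position i with ω(i) > α it equals Window(i, α) + 1.
-- So if α < ω(i) and α = ω(k) with k ≥ i, then PS_ω(α) > Window(i, α).
module Submission where

open import Defs
open import Data.Nat using (ℕ; _≤_; _<_)
open import Data.Fin using (Fin; toℕ)
open import Data.Fin.Permutation using (Permutation′)
open import Data.Product using (_×_)
open import Relation.Binary.PropositionalEquality using (_≡_; _≢_)

open import Algebra.Properties.CommutativeMonoid.Sum using (sum; sum-cong-≗; ∑-distrib-+)
open import Data.Bool using (Bool; true; false; _∧_; T; T?)
open import Data.Bool.Properties using (T-∧; T-≡; ∧-identityʳ)
open import Data.Empty using (⊥-elim)
open import Data.Fin using (zero; suc; fromℕ<)
open import Data.Fin.Permutation using (_⟨$⟩ˡ_; inverseˡ; inverseʳ)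
open import Data.Fin.Properties using (toℕ-injective; toℕ-fromℕ<; toℕ<n; any?; 0≢1+n)
  renaming (suc-injective to Fin-suc-injective)
open import Data.List using (List; []; _∷_; length; filterᵇ; tabulate; map; _++_; allFin; cartesianProduct)
open import Data.List.Properties using (filter-++; length-++)
open import Data.Nat using (zero; suc; _+_; _<ᵇ_; _≡ᵇ_; _≤′_; ≤′-refl; ≤′-step; z≤n; s≤s)
open import Data.Nat.Properties
  using (+-0-commutativeMonoid; +-identityʳ; +-comm; +-cancelʳ-≡; +-cancelʳ-≤; +-monoʳ-≤;
         ≤-refl; ≤-trans; ≤⇒≤′; <-trans; <-irrefl; <⇒≢; ≮⇒≥; <⇒<ᵇ; <ᵇ⇒<; ≡ᵇ⇒≡; n<1+n; module ≤-Reasoning)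
open import Data.Product using (_,_; proj₁; proj₂)
open import Function using (_∘_; Equivalence)
open import Relation.Nullary using (¬_; yes; no)
open import Relation.Binary.PropositionalEquality using (refl; sym; trans; cong; cong₂; subst; module ≡-Reasoning)

⟦_⟧ : Bool → ℕ
⟦ true ⟧ = 1
⟦ false ⟧ = 0

⟦⟧-T : ∀ {b} → T b → ⟦ b ⟧ ≡ 1
⟦⟧-T {true} _ = refl

T-∧ˡ : ∀ {x y} → T (x ∧ y) → T x
T-∧ˡ = proj₁ ∘ Equivalence.to T-∧

T-∧ʳ : ∀ {x y} → T (x ∧ y) → T y
T-∧ʳ = proj₂ ∘ Equivalence.to T-∧

∧-swapˡ : ∀ a b c → a ∧ b ∧ c ≡ b ∧ a ∧ c
∧-swapˡ true true c = refl
∧-swapˡ true false c = refl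
∧-swapˡ false true c = refl
∧-swapˡ false false c = refl

≡ᵇ-refl : ∀ n → (n ≡ᵇ n) ≡ true
≡ᵇ-refl zero = refl
≡ᵇ-refl (suc n) = ≡ᵇ-refl n

<ᵇ-irrefl : ∀ n → (n <ᵇ n) ≡ false
<ᵇ-irrefl zero = refl
<ᵇ-irrefl (suc n) = <ᵇ-irrefl n

app-injective : ∀ {n} (ω : Permutation′ n) {x y : Fin n} → app ω x ≡ app ω y → x ≡ y
app-injective ω e = trans (sym (inverseˡ ω)) (trans (cong (ω ⟨$⟩ˡ_) (toℕ-injective e)) (inverseˡ ω))

count : ∀ {n} → (Fin n → Bool) → ℕ
count p = sum +-0-commutativeMonoid (λ j → ⟦ p j ⟧)

count-≡0 : ∀ {n} (p : Fin n → Bool) → (∀ j → ¬ T (p j)) → count p ≡ 0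
count-≡0 {zero} p none = refl
count-≡0 {suc n} p none with p zero | none zero
... | false | _ = count-≡0 (p ∘ suc) (none ∘ suc)
... | true | ¬tt = ⊥-elim (¬tt _)

count-singleton : ∀ {n} (p : Fin n → Bool) (k : Fin n) → (∀ {j} → T (p j) → j ≡ k) →
                  count p ≡ ⟦ p k ⟧
count-singleton p zero only =
  trans (cong (⟦ p zero ⟧ +_) (count-≡0 (p ∘ suc) (λ j → 0≢1+n ∘ sym ∘ only)))
        (+-identityʳ _)
count-singleton p (suc k) only with p zero in eq
... | true = ⊥-elim (0≢1+n (only (Equivalence.from T-≡ eq)))
... | false = count-singleton (p ∘ suc) k (Fin-suc-injective ∘ only)

count-subsingleton-≤ : ∀ {n} (p : Fin n → Bool) {b : Bool} →
                       (∀ {j k} → T (p j) → T (p k) → j ≡ k) → (∀ {j} → T (p j) → T b) →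
                       count p ≤ ⟦ b ⟧
count-subsingleton-≤ p unique implies with any? (T? ∘ p)
... | yes (j , pj) = begin
  count p  ≡⟨ count-singleton p j (λ pk → unique pk pj) ⟩
  ⟦ p j ⟧  ≡⟨ ⟦⟧-T pj ⟩
  1        ≡⟨ sym (⟦⟧-T (implies pj)) ⟩
  ⟦ _ ⟧    ∎
  where open ≤-Reasoning
... | no none = begin
  count p  ≡⟨ count-≡0 p (λ j pj → none (j , pj)) ⟩
  0        ≤⟨ z≤n ⟩
  ⟦ _ ⟧    ∎
  where open ≤-Reasoning

length-filterᵇ-∷ : ∀ {A : Set} (p : A → Bool) x xs →
                   length (filterᵇ p (x ∷ xs)) ≡ ⟦ p x ⟧ + length (filterᵇ p xs)
length-filterᵇ-∷ p x xs with p x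
... | true = refl
... | false = refl

length-filterᵇ-++ : ∀ {A : Set} (p : A → Bool) xs ys →
                    length (filterᵇ p (xs ++ ys)) ≡ length (filterᵇ p xs) + length (filterᵇ p ys)
length-filterᵇ-++ p xs ys = trans (cong length (filter-++ (T? ∘ p) xs ys)) (length-++ (filterᵇ p xs))

length-filterᵇ-map : ∀ {A B : Set} (p : B → Bool) (f : A → B) xs →
                     length (filterᵇ p (map f xs)) ≡ length (filterᵇ (p ∘ f) xs)
length-filterᵇ-map p f [] = refl
length-filterᵇ-map p f (x ∷ xs) =
  trans (length-filterᵇ-∷ p (f x) (map f xs))
        (trans (cong (⟦ p (f x) ⟧ +_) (length-filterᵇ-map p f xs)) (sym (length-filterᵇ-∷ (p ∘ f) x xs)))

length-filterᵇ-tabulate : ∀ {A : Set} {n} (p : A → Bool) (f : Fin n → A) →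
                          length (filterᵇ p (tabulate f)) ≡ count (p ∘ f)
length-filterᵇ-tabulate {n = zero} p f = refl
length-filterᵇ-tabulate {n = suc n} p f =
  trans (length-filterᵇ-∷ p (f zero) (tabulate (f ∘ suc)))
        (cong (⟦ p (f zero) ⟧ +_) (length-filterᵇ-tabulate p (f ∘ suc)))

length-filterᵇ-allFin : ∀ {n} (p : Fin n → Bool) → length (filterᵇ p (allFin n)) ≡ count p
length-filterᵇ-allFin p = length-filterᵇ-tabulate p (λ j → j)

length-filterᵇ-cartesianProduct :
  ∀ {A B : Set} (q : A × B → Bool) (g : A → Bool) (xs : List A) (ys : List B) →
  (∀ x → length (filterᵇ (λ y → q (x , y)) ys) ≡ ⟦ g x ⟧) →
  length (filterᵇ q (cartesianProduct xs ys)) ≡ length (filterᵇ g xs)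
length-filterᵇ-cartesianProduct q g [] ys rows = refl
length-filterᵇ-cartesianProduct q g (x ∷ xs) ys rows = begin
  length (filterᵇ q (map (x ,_) ys ++ cartesianProduct xs ys))
    ≡⟨ length-filterᵇ-++ q (map (x ,_) ys) (cartesianProduct xs ys) ⟩
  length (filterᵇ q (map (x ,_) ys)) + length (filterᵇ q (cartesianProduct xs ys))
    ≡⟨ cong₂ _+_ (trans (length-filterᵇ-map q (x ,_) ys) (rows x))
                 (length-filterᵇ-cartesianProduct q g xs ys rows) ⟩
  ⟦ g x ⟧ + length (filterᵇ g xs)
    ≡⟨ sym (length-filterᵇ-∷ g x xs) ⟩
  length (filterᵇ g (x ∷ xs)) ∎
  where open ≡-Reasoning

-- PS_ω(ω k) only counts pairs (x , k), and those are exactly the j = x of Window(k, ω k).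
PS-app : ∀ m {n} (ω : Permutation′ n) (k : Fin n) → PS m ω (app ω k) ≡ Window m ω k (app ω k)
PS-app m {n} ω k = length-filterᵇ-cartesianProduct _ _ (allFin n) (allFin n) row
  where
  inversionAt : Fin n → Fin n → Bool → Bool
  inversionAt x y b = (toℕ x <ᵇ toℕ y) ∧ (toℕ y <ᵇ toℕ x + m) ∧ (app ω y <ᵇ app ω x) ∧ b

  row : ∀ x → length (filterᵇ (λ y → inversionAt x y (app ω y ≡ᵇ app ω k)) (allFin n))
            ≡ ⟦ (toℕ k <ᵇ toℕ x + m) ∧ (toℕ x <ᵇ toℕ k) ∧ (app ω k <ᵇ app ω x) ⟧
  row x = begin
    length (filterᵇ (λ y → inversionAt x y (app ω y ≡ᵇ app ω k)) (allFin n))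
      ≡⟨ length-filterᵇ-allFin (λ y → inversionAt x y (app ω y ≡ᵇ app ω k)) ⟩
    count (λ y → inversionAt x y (app ω y ≡ᵇ app ω k))
      ≡⟨ count-singleton _ k only-k ⟩
    ⟦ inversionAt x k (app ω k ≡ᵇ app ω k) ⟧
      ≡⟨ cong (⟦_⟧ ∘ inversionAt x k) (≡ᵇ-refl (app ω k)) ⟩
    ⟦ (toℕ x <ᵇ toℕ k) ∧ (toℕ k <ᵇ toℕ x + m) ∧ (app ω k <ᵇ app ω x) ∧ true ⟧
      ≡⟨ cong (λ b → ⟦ (toℕ x <ᵇ toℕ k) ∧ (toℕ k <ᵇ toℕ x + m) ∧ b ⟧) (∧-identityʳ (app ω k <ᵇ app ω x)) ⟩
    ⟦ (toℕ x <ᵇ toℕ k) ∧ (toℕ k <ᵇ toℕ x + m) ∧ (app ω k <ᵇ app ω x) ⟧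
      ≡⟨ cong ⟦_⟧ (∧-swapˡ (toℕ x <ᵇ toℕ k) (toℕ k <ᵇ toℕ x + m) (app ω k <ᵇ app ω x)) ⟩
    ⟦ (toℕ k <ᵇ toℕ x + m) ∧ (toℕ x <ᵇ toℕ k) ∧ (app ω k <ᵇ app ω x) ⟧ ∎
    where
    open ≡-Reasoning
    only-k : ∀ {y} → T (inversionAt x y (app ω y ≡ᵇ app ω k)) → y ≡ k
    only-k {y} t = app-injective ω (≡ᵇ⇒≡ _ _
      (T-∧ʳ {app ω y <ᵇ app ω x} (T-∧ʳ {toℕ y <ᵇ toℕ x + m} (T-∧ʳ {toℕ x <ᵇ toℕ y} t))))

-- Both sides are invariant under shifting a and p together, so these reduce to the
-- boundary cases a = 0 or p = 0.

<ᵇ-suc-split : ∀ p a t → ⟦ (p <ᵇ suc a) ∧ t ⟧ ≡ ⟦ (p <ᵇ a) ∧ t ⟧ + ⟦ (a ≡ᵇ p) ∧ t ⟧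
<ᵇ-suc-split zero zero t = refl
<ᵇ-suc-split zero (suc a) t = sym (+-identityʳ ⟦ t ⟧)
<ᵇ-suc-split (suc p) zero t = refl
<ᵇ-suc-split (suc p) (suc a) t = <ᵇ-suc-split p a t

window-indicator-split : ∀ {m} → 1 ≤ m → ∀ p a t →
  ⟦ (p <ᵇ a + m) ∧ (a <ᵇ suc p) ∧ t ⟧ ≡ ⟦ (p <ᵇ a + m) ∧ (a <ᵇ p) ∧ t ⟧ + ⟦ (a ≡ᵇ p) ∧ t ⟧
window-indicator-split (s≤s z≤n) zero zero t = refl
window-indicator-split (s≤s z≤n) (suc p) zero t = sym (+-identityʳ _)
window-indicator-split (s≤s z≤n) zero (suc a) t = refl
window-indicator-split m≥1 (suc p) (suc a) t = window-indicator-split m≥1 p a t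

window-indicator-slide : ∀ {m} → 1 ≤ m → ∀ p a t →
  ⟦ (suc p <ᵇ a + m) ∧ (a <ᵇ suc (suc p)) ∧ t ⟧ + ⟦ (a + m ≡ᵇ suc p) ∧ t ⟧
    ≡ ⟦ (p <ᵇ a + m) ∧ (a <ᵇ suc p) ∧ t ⟧ + ⟦ (a ≡ᵇ suc p) ∧ t ⟧
window-indicator-slide {suc m} (s≤s z≤n) p zero t =
  trans (sym (<ᵇ-suc-split p m t)) (sym (+-identityʳ _))
window-indicator-slide (s≤s z≤n) zero (suc zero) t = +-identityʳ ⟦ t ⟧
window-indicator-slide (s≤s z≤n) zero (suc (suc a)) t = refl
window-indicator-slide m≥1 (suc p) (suc a) t = window-indicator-slide m≥1 p a t

module SlidingWindow {m n : ℕ} (m≥1 : 1 ≤ m) (ω : Permutation′ n) (stable : IsStable m ω) (α : ℕ) where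

  exceeds : Fin n → Bool
  exceeds j = α <ᵇ app ω j

  inWindow inClosedWindow isAt isLeaving : ℕ → Fin n → Bool
  inWindow p j = (p <ᵇ toℕ j + m) ∧ (toℕ j <ᵇ p) ∧ exceeds j
  inClosedWindow p j = (p <ᵇ toℕ j + m) ∧ (toℕ j <ᵇ suc p) ∧ exceeds j
  isAt p j = (toℕ j ≡ᵇ p) ∧ exceeds j
  isLeaving p j = (toℕ j + m ≡ᵇ suc p) ∧ exceeds j

  window closedWindow atPosition leaving : ℕ → ℕ
  window = count ∘ inWindow
  closedWindow = count ∘ inClosedWindow
  atPosition = count ∘ isAt
  leaving = count ∘ isLeaving

  Window≡window : ∀ i → Window m ω i α ≡ window (toℕ i)
  Window≡window i = length-filterᵇ-allFin (inWindow (toℕ i))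

  closedWindow≡window+atPosition : ∀ p → closedWindow p ≡ window p + atPosition p
  closedWindow≡window+atPosition p =
    trans (sum-cong-≗ +-0-commutativeMonoid (λ j → window-indicator-split m≥1 p (toℕ j) (exceeds j)))
          (∑-distrib-+ +-0-commutativeMonoid (⟦_⟧ ∘ inWindow p) (⟦_⟧ ∘ isAt p))

  closedWindow-slide : ∀ p → closedWindow (suc p) + leaving p ≡ closedWindow p + atPosition (suc p)
  closedWindow-slide p =
    trans (sym (∑-distrib-+ +-0-commutativeMonoid (⟦_⟧ ∘ inClosedWindow (suc p)) (⟦_⟧ ∘ isLeaving p)))
    (trans (sum-cong-≗ +-0-commutativeMonoid (λ j → window-indicator-slide m≥1 p (toℕ j) (exceeds j)))
           (∑-distrib-+ +-0-commutativeMonoid (⟦_⟧ ∘ inClosedWindow p) (⟦_⟧ ∘ isAt (suc p))))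

  atPosition-toℕ : ∀ k → atPosition (toℕ k) ≡ ⟦ exceeds k ⟧
  atPosition-toℕ k = trans
    (count-singleton (isAt (toℕ k)) k (λ t → toℕ-injective (≡ᵇ⇒≡ _ _ (T-∧ˡ t))))
    (cong (λ b → ⟦ b ∧ exceeds k ⟧) (≡ᵇ-refl (toℕ k)))

  -- An entry leaving the window and exceeding α sits m places before the entering one.
  leaving≤exceeds : ∀ p k → toℕ k ≡ suc p → leaving p ≤ ⟦ exceeds k ⟧
  leaving≤exceeds p k k≡1+p = count-subsingleton-≤ (isLeaving p) unique implies
    where
    unique : ∀ {j j′} → T (isLeaving p j) → T (isLeaving p j′) → j ≡ j′
    unique t t′ = toℕ-injective (+-cancelʳ-≡ m _ _ (trans (≡ᵇ⇒≡ _ _ (T-∧ˡ t)) (sym (≡ᵇ⇒≡ _ _ (T-∧ˡ t′)))))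
    implies : ∀ {j} → T (isLeaving p j) → T (exceeds k)
    implies {j} t = <⇒<ᵇ (<-trans (<ᵇ⇒< α (app ω j) (T-∧ʳ t))
                                  (stable j k (trans k≡1+p (sym (≡ᵇ⇒≡ _ _ (T-∧ˡ t))))))

  closedWindow-step : ∀ p k → toℕ k ≡ suc p → closedWindow p ≤ closedWindow (suc p)
  closedWindow-step p k k≡1+p = +-cancelʳ-≤ (leaving p) _ _ (begin
    closedWindow p + leaving p           ≤⟨ +-monoʳ-≤ (closedWindow p) (leaving≤exceeds p k k≡1+p) ⟩
    closedWindow p + ⟦ exceeds k ⟧       ≡⟨ cong (closedWindow p +_) (sym (atPosition-toℕ k)) ⟩
    closedWindow p + atPosition (toℕ k)  ≡⟨ cong (λ q → closedWindow p + atPosition q) k≡1+p ⟩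
    closedWindow p + atPosition (suc p)  ≡⟨ sym (closedWindow-slide p) ⟩
    closedWindow (suc p) + leaving p     ∎)
    where open ≤-Reasoning

  closedWindow-mono : ∀ {p q} → p ≤′ q → q < n → closedWindow p ≤ closedWindow q
  closedWindow-mono ≤′-refl _ = ≤-refl
  closedWindow-mono (≤′-step {q} p≤′q) 1+q<n =
    ≤-trans (closedWindow-mono p≤′q (<-trans (n<1+n q) 1+q<n))
            (closedWindow-step q (fromℕ< 1+q<n) (toℕ-fromℕ< 1+q<n))

  closedWindow-exceeding : ∀ i → α < app ω i → closedWindow (toℕ i) ≡ suc (window (toℕ i))
  closedWindow-exceeding i α<ωi = begin
    closedWindow (toℕ i)                 ≡⟨ closedWindow≡window+atPosition (toℕ i) ⟩
    window (toℕ i) + atPosition (toℕ i)  ≡⟨ cong (window (toℕ i) +_) (atPosition-toℕ i) ⟩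
    window (toℕ i) + ⟦ exceeds i ⟧       ≡⟨ cong (window (toℕ i) +_) (⟦⟧-T (<⇒<ᵇ α<ωi)) ⟩
    window (toℕ i) + 1                   ≡⟨ +-comm _ 1 ⟩
    suc (window (toℕ i))                 ∎
    where open ≡-Reasoning

  closedWindow-at-α : ∀ k → app ω k ≡ α → closedWindow (toℕ k) ≡ window (toℕ k)
  closedWindow-at-α k ωk≡α = begin
    closedWindow (toℕ k)                 ≡⟨ closedWindow≡window+atPosition (toℕ k) ⟩
    window (toℕ k) + atPosition (toℕ k)  ≡⟨ cong (window (toℕ k) +_) (atPosition-toℕ k) ⟩
    window (toℕ k) + ⟦ α <ᵇ app ω k ⟧    ≡⟨ cong (λ v → window (toℕ k) + ⟦ α <ᵇ v ⟧) ωk≡α ⟩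
    window (toℕ k) + ⟦ α <ᵇ α ⟧          ≡⟨ cong (λ b → window (toℕ k) + ⟦ b ⟧) (<ᵇ-irrefl α) ⟩
    window (toℕ k) + 0                   ≡⟨ +-identityʳ _ ⟩
    window (toℕ k)                       ∎
    where open ≡-Reasoning

  Window-increases : ∀ i k → toℕ i ≤ toℕ k → app ω k ≡ α → α < app ω i → Window m ω i α < Window m ω k α
  Window-increases i k i≤k ωk≡α α<ωi = begin-strict
    Window m ω i α        ≡⟨ Window≡window i ⟩
    window (toℕ i)        <⟨ n<1+n _ ⟩
    suc (window (toℕ i))  ≡⟨ sym (closedWindow-exceeding i α<ωi) ⟩
    closedWindow (toℕ i)  ≤⟨ closedWindow-mono (≤⇒≤′ i≤k) (toℕ<n k) ⟩
    closedWindow (toℕ k)  ≡⟨ closedWindow-at-α k ωk≡α ⟩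
    window (toℕ k)        ≡⟨ sym (Window≡window k) ⟩
    Window m ω k α        ∎
    where open ≤-Reasoning

mainTheorem15 : (m n : ℕ) → 1 ≤ m → 1 ≤ n → (ω : Permutation′ n) → IsStable m ω → (i : Fin n) →
    (((j : Fin n) → toℕ j < toℕ i → app ω i ≢ app ω j)
      × PS m ω (app ω i) ≡ Window m ω i (app ω i))
    × ((α : ℕ) → α < n → ((j : Fin n) → toℕ j < toℕ i → α ≢ app ω j)
        → PS m ω α ≡ Window m ω i α → app ω i ≤ α)
mainTheorem15 m n m≥1 _ ω stable i = (earlier-values-differ , PS-app m ω i) , least
  where
  earlier-values-differ : (j : Fin n) → toℕ j < toℕ i → app ω i ≢ app ω j
  earlier-values-differ j j<i ωi≡ωj = <⇒≢ j<i (cong toℕ (app-injective ω (sym ωi≡ωj)))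

  least : (α : ℕ) → α < n → ((j : Fin n) → toℕ j < toℕ i → α ≢ app ω j)
          → PS m ω α ≡ Window m ω i α → app ω i ≤ α
  least α α<n fresh PS≡Window = ≮⇒≥ λ α<ωi →
    <-irrefl (trans (sym PS≡Window) PS≡Window-k) (Window-increases i k i≤k ωk≡α α<ωi)
    where
    open SlidingWindow m≥1 ω stable α
    k : Fin n
    k = ω ⟨$⟩ˡ fromℕ< α<n
    ωk≡α : app ω k ≡ α
    ωk≡α = trans (cong toℕ (inverseʳ ω)) (toℕ-fromℕ< α<n)
    i≤k : toℕ i ≤ toℕ k
    i≤k = ≮⇒≥ λ k<i → fresh k k<i (sym ωk≡α)
    PS≡Window-k : PS m ω α ≡ Window m ω k α
    PS≡Window-k = subst (λ v → PS m ω v ≡ Window m ω k v) ωk≡α (PS-app m ω k)
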